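{- For integers $r \ge 3$ and $0 \le k \le n$, \[ g^{1\text{ - }\mathrm{ff}}_r(n,k) \le (r-1) \frac{\binom{n}{\lceil \frac{(r-2)k}{r-1} \rceil}}{\binom{k}{\lceil \frac{(r-2)k}{r-1} \rceil}}. \]
   Context: Vectors in $\{0,1\}^n$ are identified with subsets of $[n]=\{1,\dots,n\}$. For $b \in \{0,1\}$, a family $x^{(0)}, x^{(1)},\ldots, x^{(r-1)}$ of $r$ distinct vectors in $\{0,1\}^n$ is $b$-focal with focus $x^{(0)}$ if for every coordinate $i \in [n]$ with $x^{(0)}_i = b$, at least $r-2$ of the $r-1$ entries $x^{(1)}_i,\ldots,x^{(r-1)}_i$ are equal to $b$. (For $b=1$ in set language: sets $A_0,A_1,\dots,A_{r-1}$, distinct, such that every element of $A_0$ lies in at least $r-2$ of $A_1,\dots,A_{r-1}$.) A family contains a $b$-focal family of size $r$ if some $r$ distinct members, with some choice of focus among them, form one. $g^{1\text{ - }\mathrm{ff}}_r(n,k)$ is the maximum of $|\mathcal{F}|$ over all families $\mathcal{F}$ of $k$-element subsets of $[n]$ containing no $1$-focal family of size $r$. -}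

module Defs where

open import Data.Nat using (ℕ; zero; suc; _+_; _*_; _∸_; _≤_)
open import Data.Nat.DivMod using (_/_)
open import Data.Bool using (Bool; true)
import Data.Bool.Properties as BoolP
open import Data.Fin using (Fin)
import Data.Fin.Properties as FinP
open import Data.Fin.Subset using (Subset; ∣_∣)
open import Data.Vec using (lookup)
open import Data.List using (List; length; filter; allFin)
open import Data.List.Membership.Propositional using (_∈_)
open import Data.List.Relation.Unary.All using (All)
open import Data.List.Relation.Unary.Unique.Propositional using (Unique)
open import Data.Product using (Σ; ∃; _×_)
open import Relation.Binary.PropositionalEquality using (_≡_)
open import Relation.Nullary using (¬_)
open import Relation.Nullary.Decidable using (¬?; _×-dec_)
open import Function.Definitions using (Injective)

-- Ceiling division ⌈ a / b ⌉ (b = 0 never used; set to 0).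
⌈_/_⌉ : ℕ → ℕ → ℕ
⌈ a / zero ⌉ = 0
⌈ a / suc b ⌉ = (a + b) / suc b

othersWithOne : ∀ {n r} → (Fin r → Subset n) → Fin r → Fin n → ℕ
othersWithOne {r = r} xs f i =
  length (filter (λ j → ¬? (j FinP.≟ f) ×-dec (lookup (xs j) i BoolP.≟ true)) (allFin r))

IsOneFocal : ∀ {n r} → (Fin r → Subset n) → Fin r → Set
IsOneFocal {n} {r} xs f =
  Injective _≡_ _≡_ xs ×
  ((i : Fin n) → lookup (xs f) i ≡ true → r ∸ 2 ≤ othersWithOne xs f i)

ContainsOneFocal : ∀ {n} → ℕ → List (Subset n) → Set
ContainsOneFocal {n} r F =
  Σ (Fin r → Subset n) λ xs → Σ (Fin r) λ f →
    ((j : Fin r) → xs j ∈ F) × IsOneFocal xs f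

IsKFamily : ∀ {n} → ℕ → List (Subset n) → Set
IsKFamily k F = Unique F × All (λ A → ∣ A ∣ ≡ k) F

-- Let m = r - 1, t = ⌈(m - 1)k/m⌉ and s = k - t, so that m s ≤ k. Call a t-subset T of a
-- member A of F private to A if no other member of F contains T; a t-set is private to at most
-- one member, so all members together have at most C(n,t) private sets. Fix A and call an
-- s-subset Q of A good if A ∖ Q is not private, i.e. lies in some other member B_Q. If m pairwise
-- disjoint good sets Q_1, ..., Q_m existed, then A, B_Q_1, ..., B_Q_m would be a 1-focal family
-- with focus A: a point of A lies in at most one Q_i, hence in at least m - 1 = r - 2 of the B's,
-- and two equal B's would contain all of A. So every sequence of m pairwise disjoint s-subsets
-- of A contains a bad set; counting these sequences with a union bound over the position of a
-- bad set gives C(k,s) ≤ m · #{bad Q} = m · #{private T ⊆ A}. Summing over A ∈ F yields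
-- |F| C(k,t) = |F| C(k,s) ≤ m C(n,t).

module Submission where

open import Defs
open import Level using (Level)
open import Data.Bool using (true; if_then_else_)
open import Data.Bool.Properties using (∧-zeroʳ)
import Data.Bool.Properties as Bool
open import Data.Nat using (ℕ; zero; suc; _+_; _*_; _∸_; _≤_; _<_; z≤n; s≤s; s≤s⁻¹; _≟_; >-nonZero)
open import Data.Nat.Properties
open import Data.Nat.DivMod using (_/_; _%_; m≡m%n+[m/n]*n; m%n<n; m<n*o⇒m/o<n)
open import Data.Nat.ListAction using (sum)
open import Data.Nat.ListAction.Properties using (sum-++)
open import Data.Nat.Combinatorics using (_C_; nCk+nC[k+1]≡[n+1]C[k+1]; nCk≡nC[n∸k])
open import Data.Nat.Solver using (module +-*-Solver)
open +-*-Solver using (solve; _:*_; _:=_)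
open import Algebra.Properties.CommutativeSemigroup +-commutativeSemigroup using (interchange)
open import Algebra.Properties.CommutativeSemigroup *-commutativeSemigroup using (x∙yz≈y∙xz)
open import Data.List using (List; []; _∷_; _++_; map; length; filter; tabulate)
open import Data.List.Properties using (map-++; map-∘; map-cong; filter-all; filter-accept; length-tabulate)
open import Data.List.Relation.Unary.All using (All)
import Data.List.Relation.Unary.All as All
open import Data.List.Relation.Unary.All.Properties using (tabulate⁺)
open import Data.List.Relation.Unary.AllPairs using (_∷_)
open import Data.List.Relation.Unary.Any as Any using (Any; any?)
open import Data.List.Relation.Unary.Unique.Propositional using (Unique)
open import Data.List.Membership.Propositional using (find; lose) renaming (_∈_ to _∈ₗ_)
open import Data.Fin using (Fin; zero; suc)
import Data.Fin.Properties as Fin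
open import Data.Fin.Subset using (Subset; outside; inside; _∈_; _∉_; _⊆_; _─_; ∣_∣; ⊤)
open import Data.Fin.Subset.Properties
  using (_⊆?_; _∈?_; p─q⊆p; x∈p∧x∉q⇒x∈p─q; drop-∷-⊆; p⊆q⇒∣p∣≤∣q∣; ⊆⊤; ∣⊤∣≡n)
open import Data.Vec using ([]; _∷_; lookup; here; there)
open import Data.Vec.Properties using (≡-dec; []=⇒lookup; lookup⇒[]=)
open import Data.Product using (_×_; _,_; ∃; proj₁; proj₂)
open import Function using (_∘_; _⇔_; mk⇔; Equivalence)
open import Function.Definitions using (Injective)
open import Relation.Nullary using (Dec; does; yes; no; ¬_; ¬?; contradiction)
open import Relation.Nullary.Decidable using (_×-dec_; does-⇔)
open import Relation.Unary using (Pred; Decidable)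
open import Relation.Binary.PropositionalEquality

private variable
  a b p : Level
  A : Set a
  B : Set b
  n : ℕ

-- Indicators and finite sums

-- Defined through does so that indicators of _⊆?_ and _≟_ on explicit vectors compute.
𝟙 : Dec A → ℕ
𝟙 a? = if does a? then 1 else 0

𝟙-× : (a? : Dec A) (b? : Dec B) → 𝟙 (a? ×-dec b?) ≡ 𝟙 a? * 𝟙 b?
𝟙-× (yes _) (yes _) = refl
𝟙-× (yes _) (no _)  = refl
𝟙-× (no _)  _       = refl

𝟙-⇔ : A ⇔ B → (a? : Dec A) (b? : Dec B) → 𝟙 a? ≡ 𝟙 b?
𝟙-⇔ A⇔B a? b? = cong (if_then 1 else 0) (does-⇔ A⇔B a? b?)

𝟙-split : (a? : Dec A) (b? : Dec B) → 𝟙 a? ≡ 𝟙 (a? ×-dec b?) + 𝟙 (a? ×-dec ¬? b?)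
𝟙-split (yes _) (yes _) = refl
𝟙-split (yes _) (no _)  = refl
𝟙-split (no _)  _       = refl

𝟙-mono : (A → B) → (a? : Dec A) (b? : Dec B) → 𝟙 a? ≤ 𝟙 b?
𝟙-mono _   (yes _) (yes _) = s≤s z≤n
𝟙-mono A→B (yes a) (no ¬b) = contradiction (A→B a) ¬b
𝟙-mono _   (no _)  _       = z≤n

𝟙≡0 : (a? : Dec A) → ¬ A → 𝟙 a? ≡ 0
𝟙≡0 (yes a) ¬a = contradiction a ¬a
𝟙≡0 (no _)  _  = refl

𝟙*-cong : ∀ {x y} (a? : Dec A) → (A → x ≡ y) → 𝟙 a? * x ≡ 𝟙 a? * y
𝟙*-cong (yes a) x≡y = cong (_+ 0) (x≡y a)
𝟙*-cong (no _)  _   = refl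

𝟙*-mono : ∀ {x y} (a? : Dec A) → (A → x ≤ y) → 𝟙 a? * x ≤ 𝟙 a? * y
𝟙*-mono (yes a) x≤y = +-monoˡ-≤ 0 (x≤y a)
𝟙*-mono (no _)  _   = z≤n

∑ : List A → (A → ℕ) → ℕ
∑ xs f = sum (map f xs)

infix 5 ∑
syntax ∑ xs (λ x → e) = ∑[ x ∈ xs ] e

∑-cong : ∀ (xs : List A) {f g : A → ℕ} → (∀ x → f x ≡ g x) → ∑ xs f ≡ ∑ xs g
∑-cong xs f≗g = cong sum (map-cong f≗g xs)

∑-++ : ∀ (xs ys : List A) f → ∑ (xs ++ ys) f ≡ ∑ xs f + ∑ ys f
∑-++ xs ys f = trans (cong sum (map-++ f xs ys)) (sum-++ (map f xs) (map f ys))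

∑-map : ∀ (g : A → B) xs f → ∑ (map g xs) f ≡ ∑ xs (f ∘ g)
∑-map g xs f = cong sum (sym (map-∘ xs))

∑-const : ∀ (xs : List A) c → ∑[ _ ∈ xs ] c ≡ length xs * c
∑-const []       c = refl
∑-const (x ∷ xs) c = cong (c +_) (∑-const xs c)

∑-zero : ∀ (xs : List A) → ∑[ _ ∈ xs ] 0 ≡ 0
∑-zero xs = trans (∑-const xs 0) (*-zeroʳ (length xs))

∑-mono : ∀ (xs : List A) {f g : A → ℕ} → (∀ x → f x ≤ g x) → ∑ xs f ≤ ∑ xs g
∑-mono []       f≤g = z≤n
∑-mono (x ∷ xs) f≤g = +-mono-≤ (f≤g x) (∑-mono xs f≤g)

∑-mono-∈ : ∀ (xs : List A) {f g : A → ℕ} → (∀ {x} → x ∈ₗ xs → f x ≤ g x) → ∑ xs f ≤ ∑ xs g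
∑-mono-∈ []       f≤g = z≤n
∑-mono-∈ (x ∷ xs) f≤g = +-mono-≤ (f≤g (Any.here refl)) (∑-mono-∈ xs (f≤g ∘ Any.there))

∑-distrib-+ : ∀ (xs : List A) f g → ∑[ x ∈ xs ] (f x + g x) ≡ ∑ xs f + ∑ xs g
∑-distrib-+ []       f g = refl
∑-distrib-+ (x ∷ xs) f g =
  trans (cong (f x + g x +_) (∑-distrib-+ xs f g)) (interchange (f x) (g x) (∑ xs f) (∑ xs g))

*-distribˡ-∑ : ∀ (xs : List A) c f → ∑[ x ∈ xs ] c * f x ≡ c * ∑ xs f
*-distribˡ-∑ []       c f = sym (*-zeroʳ c)
*-distribˡ-∑ (x ∷ xs) c f = trans (cong (c * f x +_) (*-distribˡ-∑ xs c f)) (sym (*-distribˡ-+ c (f x) _))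

*-distribʳ-∑ : ∀ (xs : List A) c f → ∑[ x ∈ xs ] f x * c ≡ ∑ xs f * c
*-distribʳ-∑ []       c f = refl
*-distribʳ-∑ (x ∷ xs) c f = trans (cong (f x * c +_) (*-distribʳ-∑ xs c f)) (sym (*-distribʳ-+ c (f x) _))

∑-comm : ∀ (xs : List A) (ys : List B) (f : A → B → ℕ) →
  ∑[ x ∈ xs ] ∑[ y ∈ ys ] f x y ≡ ∑[ y ∈ ys ] ∑[ x ∈ xs ] f x y
∑-comm []       ys f = sym (∑-zero ys)
∑-comm (x ∷ xs) ys f =
  trans (cong (∑ ys (f x) +_) (∑-comm xs ys f)) (sym (∑-distrib-+ ys (f x) (λ y → ∑[ x ∈ xs ] f x y)))

∑-𝟙≤1 : ∀ {P : Pred A p} (P? : Decidable P) {xs} → Unique xs →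
  (∀ {x y} → x ∈ₗ xs → y ∈ₗ xs → P x → P y → x ≡ y) → ∑[ x ∈ xs ] 𝟙 (P? x) ≤ 1
∑-𝟙≤1 P? {[]}     _                _        = z≤n
∑-𝟙≤1 P? {x ∷ xs} (x∉xs ∷ unique) P-unique with P? x
... | yes Px = s≤s (≤-trans (∑-mono-∈ xs λ {y} y∈xs → ≤-reflexive (𝟙≡0 (P? y) λ Py →
                   All.lookup x∉xs y∈xs (P-unique (Any.here refl) (Any.there y∈xs) Px Py)))
                   (≤-reflexive (∑-zero xs)))
... | no _   = ∑-𝟙≤1 P? unique λ x∈xs y∈xs → P-unique (Any.there x∈xs) (Any.there y∈xs)

-- Counting subsets of [n]

allSubsets : ∀ n → List (Subset n)
allSubsets zero    = [] ∷ []
allSubsets (suc n) = map (outside ∷_) (allSubsets n) ++ map (inside ∷_) (allSubsets n)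

∑-allSubsets : ∀ n (f : Subset (suc n) → ℕ) →
  ∑ (allSubsets (suc n)) f ≡ (∑[ P ∈ allSubsets n ] f (outside ∷ P)) + (∑[ P ∈ allSubsets n ] f (inside ∷ P))
∑-allSubsets n f = trans (∑-++ (map (outside ∷_) (allSubsets n)) _ f)
  (cong₂ _+_ (∑-map (outside ∷_) (allSubsets n) f) (∑-map (inside ∷_) (allSubsets n) f))

infix 4 _⊆[_]_ _⊆[_]?_

_⊆[_]_ : Subset n → ℕ → Subset n → Set
P ⊆[ s ] X = ∣ P ∣ ≡ s × P ⊆ X

_⊆[_]?_ : (P : Subset n) (s : ℕ) (X : Subset n) → Dec (P ⊆[ s ] X)
P ⊆[ s ]? X = (∣ P ∣ ≟ s) ×-dec (P ⊆? X)

∑-⊆[] : ∀ n s (X : Subset n) → ∑[ P ∈ allSubsets n ] 𝟙 (P ⊆[ s ]? X) ≡ ∣ X ∣ C s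
∑-⊆[] zero zero    [] = refl
∑-⊆[] zero (suc s) [] = refl
∑-⊆[] (suc n) s (x ∷ X) = trans (∑-allSubsets n _) (halves s x)
  where
  halves : ∀ s x → (∑[ P ∈ allSubsets n ] 𝟙 (P ⊆[ s ]? X))
                   + (∑[ P ∈ allSubsets n ] 𝟙 ((inside ∷ P) ⊆[ s ]? (x ∷ X)))
                 ≡ ∣ x ∷ X ∣ C s
  halves zero x = cong₂ _+_ (∑-⊆[] n 0 X) (∑-zero (allSubsets n))
  halves (suc s) outside = trans (cong₂ _+_ (∑-⊆[] n (suc s) X) inside-half) (+-identityʳ _)
    where
    inside-half : ∑[ P ∈ allSubsets n ] 𝟙 ((inside ∷ P) ⊆[ suc s ]? (outside ∷ X)) ≡ 0
    inside-half = trans (∑-cong (allSubsets n) λ P → cong (if_then 1 else 0) (∧-zeroʳ (does (∣ P ∣ ≟ s))))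
                        (∑-zero (allSubsets n))
  halves (suc s) inside = trans (cong₂ _+_ (∑-⊆[] n (suc s) X) (∑-⊆[] n s X))
    (trans (+-comm (∣ X ∣ C suc s) _) (nCk+nC[k+1]≡[n+1]C[k+1] ∣ X ∣ s))

x∈p─q⇒x∉q : ∀ {x : Fin n} {p q} → x ∈ p ─ q → x ∉ q
x∈p─q⇒x∉q {p = _ ∷ _} {outside ∷ _} (there x∈p─q) (there x∈q) = x∈p─q⇒x∉q x∈p─q x∈q
x∈p─q⇒x∉q {p = _ ∷ _} {inside ∷ _}  (there x∈p─q) (there x∈q) = x∈p─q⇒x∉q x∈p─q x∈q

─-swap : ∀ {P Q X : Subset n} → P ⊆ X → Q ⊆ X ─ P → P ⊆ X ─ Q
─-swap P⊆X Q⊆X─P x∈P = x∈p∧x∉q⇒x∈p─q (P⊆X x∈P) (λ x∈Q → x∈p─q⇒x∉q (Q⊆X─P x∈Q) x∈P)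

∣─∣+∣∣ : ∀ {P X : Subset n} → P ⊆ X → ∣ X ─ P ∣ + ∣ P ∣ ≡ ∣ X ∣
∣─∣+∣∣ {P = []}          {[]}          _   = refl
∣─∣+∣∣ {P = outside ∷ P} {outside ∷ X} P⊆X = ∣─∣+∣∣ (drop-∷-⊆ P⊆X)
∣─∣+∣∣ {P = outside ∷ P} {inside ∷ X}  P⊆X = cong suc (∣─∣+∣∣ (drop-∷-⊆ P⊆X))
∣─∣+∣∣ {P = inside ∷ P}  {inside ∷ X}  P⊆X = trans (+-suc _ _) (cong suc (∣─∣+∣∣ (drop-∷-⊆ P⊆X)))
∣─∣+∣∣ {P = inside ∷ P}  {outside ∷ X} P⊆X = contradiction (P⊆X here) λ ()

⊆∧∣∣≡⇒≡ : ∀ {P X : Subset n} → P ⊆ X → ∣ P ∣ ≡ ∣ X ∣ → P ≡ X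
⊆∧∣∣≡⇒≡ {P = []}          {[]}          _   _ = refl
⊆∧∣∣≡⇒≡ {P = outside ∷ P} {outside ∷ X} P⊆X e = cong (outside ∷_) (⊆∧∣∣≡⇒≡ (drop-∷-⊆ P⊆X) e)
⊆∧∣∣≡⇒≡ {P = inside ∷ P}  {inside ∷ X}  P⊆X e = cong (inside ∷_) (⊆∧∣∣≡⇒≡ (drop-∷-⊆ P⊆X) (suc-injective e))
⊆∧∣∣≡⇒≡ {P = outside ∷ P} {inside ∷ X}  P⊆X e =
  contradiction (≤-reflexive (sym e)) (<⇒≱ (s≤s (p⊆q⇒∣p∣≤∣q∣ (drop-∷-⊆ P⊆X))))
⊆∧∣∣≡⇒≡ {P = inside ∷ P}  {outside ∷ X} P⊆X e = contradiction (P⊆X here) λ ()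

∣─∣ : ∀ {P X : Subset n} {s} → P ⊆[ s ] X → ∣ X ─ P ∣ ≡ ∣ X ∣ ∸ s
∣─∣ {P = P} {X} (refl , P⊆X) = trans (sym (m+n∸n≡m ∣ X ─ P ∣ ∣ P ∣)) (cong (_∸ ∣ P ∣) (∣─∣+∣∣ P⊆X))

⊆[]-─-swap : ∀ {P Q X : Subset n} {s t} → P ⊆[ s ] X → Q ⊆[ t ] X ─ P → Q ⊆[ t ] X × P ⊆[ s ] X ─ Q
⊆[]-─-swap {X = X} (∣P∣ , P⊆X) (∣Q∣ , Q⊆X─P) = (∣Q∣ , p─q⊆p X _ ∘ Q⊆X─P) , (∣P∣ , ─-swap P⊆X Q⊆X─P)

-- Q ↦ A ─ Q permutes the subsets of A.
∑-─ : ∀ n (A : Subset n) (f : Subset n → ℕ) →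
  ∑[ Q ∈ allSubsets n ] 𝟙 (Q ⊆? A) * f (A ─ Q) ≡ ∑[ T ∈ allSubsets n ] 𝟙 (T ⊆? A) * f T
∑-─ zero [] f = refl
∑-─ (suc n) (outside ∷ A) f = begin
  ∑[ Q ∈ allSubsets (suc n) ] 𝟙 (Q ⊆? outside ∷ A) * f ((outside ∷ A) ─ Q)
    ≡⟨ ∑-allSubsets n _ ⟩
  S (λ Q → f (outside ∷ (A ─ Q))) + (∑[ _ ∈ allSubsets n ] 0)
    ≡⟨ cong (_+ _) (∑-─ n A (f ∘ (outside ∷_))) ⟩
  S (f ∘ (outside ∷_)) + (∑[ _ ∈ allSubsets n ] 0)
    ≡⟨ ∑-allSubsets n _ ⟨
  ∑[ T ∈ allSubsets (suc n) ] 𝟙 (T ⊆? outside ∷ A) * f T ∎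
  where
  open ≡-Reasoning
  S : (Subset n → ℕ) → ℕ
  S h = ∑[ T ∈ allSubsets n ] 𝟙 (T ⊆? A) * h T
∑-─ (suc n) (inside ∷ A) f = begin
  ∑[ Q ∈ allSubsets (suc n) ] 𝟙 (Q ⊆? inside ∷ A) * f ((inside ∷ A) ─ Q)
    ≡⟨ ∑-allSubsets n _ ⟩
  S (λ Q → f (inside ∷ (A ─ Q))) + S (λ Q → f (outside ∷ (A ─ Q)))
    ≡⟨ cong₂ _+_ (∑-─ n A (f ∘ (inside ∷_))) (∑-─ n A (f ∘ (outside ∷_))) ⟩
  S (f ∘ (inside ∷_)) + S (f ∘ (outside ∷_))
    ≡⟨ +-comm (S (f ∘ (inside ∷_))) _ ⟩
  S (f ∘ (outside ∷_)) + S (f ∘ (inside ∷_))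
    ≡⟨ ∑-allSubsets n _ ⟨
  ∑[ T ∈ allSubsets (suc n) ] 𝟙 (T ⊆? inside ∷ A) * f T ∎
  where
  open ≡-Reasoning
  S : (Subset n → ℕ) → ℕ
  S h = ∑[ T ∈ allSubsets n ] 𝟙 (T ⊆? A) * h T

∣∣≡∸⇔∣─∣≡ : ∀ {Q A : Subset n} {k t} → Q ⊆ A → ∣ A ∣ ≡ k → t ≤ k → (∣ Q ∣ ≡ k ∸ t ⇔ ∣ A ─ Q ∣ ≡ t)
∣∣≡∸⇔∣─∣≡ {Q = Q} {A} {k} {t} Q⊆A ∣A∣≡k t≤k = mk⇔
  (λ ∣Q∣≡k∸t → begin
    ∣ A ─ Q ∣               ≡⟨ m+n∸n≡m ∣ A ─ Q ∣ ∣ Q ∣ ⟨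
    ∣ A ─ Q ∣ + ∣ Q ∣ ∸ ∣ Q ∣ ≡⟨ cong₂ _∸_ sum≡k ∣Q∣≡k∸t ⟩
    k ∸ (k ∸ t)             ≡⟨ m∸[m∸n]≡n t≤k ⟩
    t                       ∎)
  (λ ∣A─Q∣≡t → begin
    ∣ Q ∣                        ≡⟨ m+n∸m≡n ∣ A ─ Q ∣ ∣ Q ∣ ⟨
    ∣ A ─ Q ∣ + ∣ Q ∣ ∸ ∣ A ─ Q ∣ ≡⟨ cong₂ _∸_ sum≡k ∣A─Q∣≡t ⟩
    k ∸ t                        ∎)
  where
  open ≡-Reasoning
  sum≡k : ∣ A ─ Q ∣ + ∣ Q ∣ ≡ k
  sum≡k = trans (∣─∣+∣∣ Q⊆A) ∣A∣≡k

-- Sequences of pairwise disjoint choices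

iteratedChoose : ℕ → ℕ → ℕ → ℕ
iteratedChoose s zero    x = 1
iteratedChoose s (suc j) x = (x C s) * iteratedChoose s j (x ∸ s)

0<C : ∀ {x s} → s ≤ x → 0 < x C s
0<C {s = zero} _ = s≤s z≤n
0<C {suc x} {suc s} (s≤s s≤x) =
  ≤-trans (0<C s≤x) (≤-trans (m≤m+n (x C s) _) (≤-reflexive (nCk+nC[k+1]≡[n+1]C[k+1] x s)))

suc*≤⇒*≤∸ : ∀ j s {x} → suc j * s ≤ x → j * s ≤ x ∸ s
suc*≤⇒*≤∸ j s js≤x = m+n≤o⇒m≤o∸n (j * s) (≤-trans (≤-reflexive (+-comm (j * s) s)) js≤x)

0<iteratedChoose : ∀ s j {x} → j * s ≤ x → 0 < iteratedChoose s j x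
0<iteratedChoose s zero    _    = s≤s z≤n
0<iteratedChoose s (suc j) js≤x =
  *-mono-< (0<C (m+n≤o⇒m≤o s js≤x)) (0<iteratedChoose s j (suc*≤⇒*≤∸ j s js≤x))

disjointChoices : ℕ → ℕ → Subset n → ℕ
disjointChoices s zero    X = 1
disjointChoices s (suc j) X = ∑[ P ∈ allSubsets _ ] 𝟙 (P ⊆[ s ]? X) * disjointChoices s j (X ─ P)

disjointChoices≡iteratedChoose : ∀ s j (X : Subset n) → disjointChoices s j X ≡ iteratedChoose s j ∣ X ∣
disjointChoices≡iteratedChoose s zero    X = refl
disjointChoices≡iteratedChoose {n} s (suc j) X = begin
  ∑[ P ∈ allSubsets n ] 𝟙 (P ⊆[ s ]? X) * disjointChoices s j (X ─ P)
    ≡⟨ ∑-cong (allSubsets n) (λ P → 𝟙*-cong (P ⊆[ s ]? X) λ P⊆X →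
         trans (disjointChoices≡iteratedChoose s j (X ─ P)) (cong (iteratedChoose s j) (∣─∣ P⊆X))) ⟩
  ∑[ P ∈ allSubsets n ] 𝟙 (P ⊆[ s ]? X) * iteratedChoose s j (∣ X ∣ ∸ s)
    ≡⟨ *-distribʳ-∑ (allSubsets n) _ (λ P → 𝟙 (P ⊆[ s ]? X)) ⟩
  (∑[ P ∈ allSubsets n ] 𝟙 (P ⊆[ s ]? X)) * iteratedChoose s j (∣ X ∣ ∸ s)
    ≡⟨ cong (_* iteratedChoose s j (∣ X ∣ ∸ s)) (∑-⊆[] n s X) ⟩
  (∣ X ∣ C s) * iteratedChoose s j (∣ X ∣ ∸ s) ∎
  where open ≡-Reasoning

record DisjointFamily {g} (Good : Subset n → Set g) (j : ℕ) (X : Subset n) : Set g where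
  field
    member   : Fin j → Subset n
    member⊆  : ∀ i → member i ⊆ X
    good     : ∀ i → Good (member i)
    disjoint : ∀ {i i′ x} → i ≢ i′ → x ∈ member i → x ∉ member i′

module _ {g} {Good : Subset n → Set g} where

  open DisjointFamily

  emptyFamily : ∀ X → DisjointFamily Good 0 X
  emptyFamily X = record { member = λ () ; member⊆ = λ () ; good = λ () ; disjoint = λ {i} → λ { {()} } }

  consFamily : ∀ {j P X} → P ⊆ X → Good P → DisjointFamily Good j (X ─ P) → DisjointFamily Good (suc j) X
  consFamily {P = P} {X} P⊆X goodP 𝓠 = record
    { member   = Q
    ; member⊆  = Q⊆X
    ; good     = λ { zero → goodP ; (suc i) → good 𝓠 i }
    ; disjoint = Q-disjoint
    }
    where
    Q : Fin (suc _) → Subset n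
    Q zero    = P
    Q (suc i) = member 𝓠 i
    Q⊆X : ∀ i → Q i ⊆ X
    Q⊆X zero    = P⊆X
    Q⊆X (suc i) = p─q⊆p X P ∘ member⊆ 𝓠 i
    Q-disjoint : ∀ {i i′ x} → i ≢ i′ → x ∈ Q i → x ∉ Q i′
    Q-disjoint {zero}  {zero}   i≢i′ _   = contradiction refl i≢i′
    Q-disjoint {zero}  {suc i′} _    x∈P x∈Q = x∈p─q⇒x∉q (member⊆ 𝓠 i′ x∈Q) x∈P
    Q-disjoint {suc i} {zero}   _    x∈Q = x∈p─q⇒x∉q (member⊆ 𝓠 i x∈Q)
    Q-disjoint {suc i} {suc i′} i≢i′ = disjoint 𝓠 (i≢i′ ∘ cong suc)

module _ {g} {Good : Subset n → Set g} {j} {X : Subset n} (𝓠 : DisjointFamily Good (suc j) X) where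

  open DisjointFamily 𝓠

  missesAllButOne : ∀ x → ∃ λ i₀ → ∀ i → i ≢ i₀ → x ∉ member i
  missesAllButOne x with Fin.any? (λ i → x ∈? member i)
  ... | yes (i₀ , x∈Qi₀) = i₀ , λ i i≢i₀ → disjoint (i≢i₀ ∘ sym) x∈Qi₀
  ... | no ∄i            = zero , λ i _ x∈Qi → ∄i (i , x∈Qi)


module DisjointChoices {n : ℕ} (s : ℕ) {g} {Good : Subset n → Set g} (good? : Decidable Good) where

  BadIn : Subset n → Subset n → Set g
  BadIn X Q = Q ⊆[ s ] X × ¬ Good Q

  badIn? : ∀ X Q → Dec (BadIn X Q)
  badIn? X Q = Q ⊆[ s ]? X ×-dec ¬? (good? Q)

  goodIn? : ∀ X P → Dec (P ⊆[ s ] X × Good P)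
  goodIn? X P = P ⊆[ s ]? X ×-dec good? P

  bad : Subset n → ℕ
  bad X = ∑[ Q ∈ allSubsets n ] 𝟙 (badIn? X Q)

  -- Both sides count the pairs (P, Q) of disjoint s-subsets of X with Q bad.
  ∑-bad─ : ∀ X → ∑[ P ∈ allSubsets n ] 𝟙 (P ⊆[ s ]? X) * bad (X ─ P) ≡ bad X * ((∣ X ∣ ∸ s) C s)
  ∑-bad─ X = begin
    ∑[ P ∈ allSubsets n ] 𝟙 (P ⊆[ s ]? X) * bad (X ─ P)
      ≡⟨ ∑-cong (allSubsets n) (λ P →
           *-distribˡ-∑ (allSubsets n) (𝟙 (P ⊆[ s ]? X)) (𝟙 ∘ badIn? (X ─ P))) ⟨
    ∑[ P ∈ allSubsets n ] ∑[ Q ∈ allSubsets n ] 𝟙 (P ⊆[ s ]? X) * 𝟙 (badIn? (X ─ P) Q)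
      ≡⟨ ∑-cong (allSubsets n) (λ P → ∑-cong (allSubsets n) (disjointPair-sym P)) ⟩
    ∑[ P ∈ allSubsets n ] ∑[ Q ∈ allSubsets n ] 𝟙 (badIn? X Q) * 𝟙 (P ⊆[ s ]? X ─ Q)
      ≡⟨ ∑-comm (allSubsets n) (allSubsets n) _ ⟩
    ∑[ Q ∈ allSubsets n ] ∑[ P ∈ allSubsets n ] 𝟙 (badIn? X Q) * 𝟙 (P ⊆[ s ]? X ─ Q)
      ≡⟨ ∑-cong (allSubsets n) (λ Q →
           *-distribˡ-∑ (allSubsets n) (𝟙 (badIn? X Q)) (λ P → 𝟙 (P ⊆[ s ]? X ─ Q))) ⟩
    ∑[ Q ∈ allSubsets n ] 𝟙 (badIn? X Q) * (∑[ P ∈ allSubsets n ] 𝟙 (P ⊆[ s ]? X ─ Q))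
      ≡⟨ ∑-cong (allSubsets n) (λ Q → 𝟙*-cong (badIn? X Q) λ (Q⊆X , _) →
           trans (∑-⊆[] n s (X ─ Q)) (cong (_C s) (∣─∣ Q⊆X))) ⟩
    ∑[ Q ∈ allSubsets n ] 𝟙 (badIn? X Q) * ((∣ X ∣ ∸ s) C s)
      ≡⟨ *-distribʳ-∑ (allSubsets n) _ (𝟙 ∘ badIn? X) ⟩
    bad X * ((∣ X ∣ ∸ s) C s) ∎
    where
    open ≡-Reasoning
    disjointPair-sym : ∀ P Q →
      𝟙 (P ⊆[ s ]? X) * 𝟙 (badIn? (X ─ P) Q) ≡ 𝟙 (badIn? X Q) * 𝟙 (P ⊆[ s ]? X ─ Q)
    disjointPair-sym P Q = begin
      𝟙 (P ⊆[ s ]? X) * 𝟙 (badIn? (X ─ P) Q)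
        ≡⟨ 𝟙-× (P ⊆[ s ]? X) (badIn? (X ─ P) Q) ⟨
      𝟙 (P ⊆[ s ]? X ×-dec badIn? (X ─ P) Q)
        ≡⟨ 𝟙-⇔ (mk⇔ swap swap′) (P ⊆[ s ]? X ×-dec badIn? (X ─ P) Q) (badIn? X Q ×-dec P ⊆[ s ]? X ─ Q) ⟩
      𝟙 (badIn? X Q ×-dec P ⊆[ s ]? X ─ Q)
        ≡⟨ 𝟙-× (badIn? X Q) (P ⊆[ s ]? X ─ Q) ⟩
      𝟙 (badIn? X Q) * 𝟙 (P ⊆[ s ]? X ─ Q) ∎
      where
      swap : P ⊆[ s ] X × BadIn (X ─ P) Q → BadIn X Q × P ⊆[ s ] X ─ Q
      swap (P⊆X , Q⊆X─P , ¬goodQ) = let (Q⊆X , P⊆X─Q) = ⊆[]-─-swap P⊆X Q⊆X─P in (Q⊆X , ¬goodQ) , P⊆X─Q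
      swap′ : BadIn X Q × P ⊆[ s ] X ─ Q → P ⊆[ s ] X × BadIn (X ─ P) Q
      swap′ ((Q⊆X , ¬goodQ) , P⊆X─Q) = let (P⊆X , Q⊆X─P) = ⊆[]-─-swap Q⊆X P⊆X─Q in P⊆X , Q⊆X─P , ¬goodQ

  -- Split on the first choice P: bad ones are counted by bad X, and after a good one X ─ P
  -- contains no j pairwise disjoint good sets, so induction applies and ∑-bad─ resums.
  disjointChoices-≤ : ∀ j X → ¬ DisjointFamily Good (suc j) X →
    disjointChoices s (suc j) X ≤ suc j * (bad X * iteratedChoose s j (∣ X ∣ ∸ s))
  goodFirstChoices-≤ : ∀ j X → ¬ DisjointFamily Good (suc j) X →
    ∑[ P ∈ allSubsets n ] 𝟙 (goodIn? X P) * disjointChoices s j (X ─ P)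
      ≤ j * (bad X * iteratedChoose s j (∣ X ∣ ∸ s))

  disjointChoices-≤ j X no𝓠 = begin
    disjointChoices s (suc j) X
      ≡⟨ ∑-cong (allSubsets n) split ⟩
    ∑[ P ∈ allSubsets n ] (goodTerm P + badTerm P)
      ≡⟨ ∑-distrib-+ (allSubsets n) goodTerm badTerm ⟩
    ∑ (allSubsets n) goodTerm + ∑ (allSubsets n) badTerm
      ≤⟨ +-monoˡ-≤ _ (goodFirstChoices-≤ j X no𝓠) ⟩
    j * (bad X * M) + ∑ (allSubsets n) badTerm
      ≡⟨ cong (j * (bad X * M) +_) badChoices ⟩
    j * (bad X * M) + bad X * M
      ≡⟨ +-comm (j * (bad X * M)) _ ⟩
    suc j * (bad X * M) ∎
    where
    open ≤-Reasoning
    M = iteratedChoose s j (∣ X ∣ ∸ s)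
    goodTerm badTerm : Subset n → ℕ
    goodTerm P = 𝟙 (goodIn? X P) * disjointChoices s j (X ─ P)
    badTerm  P = 𝟙 (badIn? X P) * disjointChoices s j (X ─ P)
    split : ∀ P → 𝟙 (P ⊆[ s ]? X) * disjointChoices s j (X ─ P) ≡ goodTerm P + badTerm P
    split P = trans (cong (_* disjointChoices s j (X ─ P)) (𝟙-split (P ⊆[ s ]? X) (good? P)))
                    (*-distribʳ-+ (disjointChoices s j (X ─ P)) (𝟙 (goodIn? X P)) (𝟙 (badIn? X P)))
    badChoices : ∑ (allSubsets n) badTerm ≡ bad X * M
    badChoices = trans (∑-cong (allSubsets n) (λ P → 𝟙*-cong (badIn? X P) λ (P⊆X , _) →
                   trans (disjointChoices≡iteratedChoose s j (X ─ P)) (cong (iteratedChoose s j) (∣─∣ P⊆X))))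
                 (*-distribʳ-∑ (allSubsets n) M (𝟙 ∘ badIn? X))

  goodFirstChoices-≤ zero X no𝓠 =
    ≤-reflexive (trans (∑-cong (allSubsets n) noGoodChoice) (∑-zero (allSubsets n)))
    where
    noGoodChoice : ∀ P → 𝟙 (goodIn? X P) * 1 ≡ 0
    noGoodChoice P = cong (_* 1) (𝟙≡0 (goodIn? X P) λ ((_ , P⊆X) , goodP) →
                       no𝓠 (consFamily P⊆X goodP (emptyFamily (X ─ P))))
  goodFirstChoices-≤ (suc j) X no𝓠 = begin
    ∑[ P ∈ allSubsets n ] 𝟙 (goodIn? X P) * disjointChoices s (suc j) (X ─ P)
      ≤⟨ ∑-mono (allSubsets n) (λ P → 𝟙*-mono (goodIn? X P) (afterGoodChoice P)) ⟩
    ∑[ P ∈ allSubsets n ] 𝟙 (goodIn? X P) * (suc j * (bad (X ─ P) * M))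
      ≤⟨ ∑-mono (allSubsets n) (λ P → *-monoˡ-≤ _ (𝟙-mono proj₁ (goodIn? X P) (P ⊆[ s ]? X))) ⟩
    ∑[ P ∈ allSubsets n ] 𝟙 (P ⊆[ s ]? X) * (suc j * (bad (X ─ P) * M))
      ≡⟨ ∑-cong (allSubsets n) (λ P → factor (𝟙 (P ⊆[ s ]? X)) (bad (X ─ P))) ⟩
    ∑[ P ∈ allSubsets n ] suc j * M * (𝟙 (P ⊆[ s ]? X) * bad (X ─ P))
      ≡⟨ *-distribˡ-∑ (allSubsets n) (suc j * M) (λ P → 𝟙 (P ⊆[ s ]? X) * bad (X ─ P)) ⟩
    suc j * M * (∑[ P ∈ allSubsets n ] 𝟙 (P ⊆[ s ]? X) * bad (X ─ P))
      ≡⟨ cong (suc j * M *_) (∑-bad─ X) ⟩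
    suc j * M * (bad X * ((∣ X ∣ ∸ s) C s))
      ≡⟨ unfactor (bad X) ((∣ X ∣ ∸ s) C s) ⟨
    suc j * (bad X * (((∣ X ∣ ∸ s) C s) * M)) ∎
    where
    open ≤-Reasoning
    M = iteratedChoose s j (∣ X ∣ ∸ s ∸ s)
    afterGoodChoice : ∀ P → P ⊆[ s ] X × Good P → disjointChoices s (suc j) (X ─ P) ≤ suc j * (bad (X ─ P) * M)
    afterGoodChoice P (P⊆X , goodP) =
      subst (λ x → disjointChoices s (suc j) (X ─ P) ≤ suc j * (bad (X ─ P) * iteratedChoose s j (x ∸ s)))
            (∣─∣ P⊆X) (disjointChoices-≤ j (X ─ P) (no𝓠 ∘ consFamily (proj₂ P⊆X) goodP))
    factor unfactor : ∀ a b → _ ≡ suc j * M * (a * b)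
    factor   a b = solve 4 (λ a b c m → a :* (c :* (b :* m)) := c :* m :* (a :* b)) refl a b (suc j) M
    unfactor a b = solve 4 (λ a b c m → c :* (a :* (b :* m)) := c :* m :* (a :* b)) refl a b (suc j) M

  C≤*bad : ∀ j X → suc j * s ≤ ∣ X ∣ → ¬ DisjointFamily Good (suc j) X → ∣ X ∣ C s ≤ suc j * bad X
  C≤*bad j X js≤∣X∣ no𝓠 = *-cancelʳ-≤ (∣ X ∣ C s) (suc j * bad X) M {{>-nonZero M>0}} (begin
    (∣ X ∣ C s) * M             ≡⟨ disjointChoices≡iteratedChoose s (suc j) X ⟨
    disjointChoices s (suc j) X ≤⟨ disjointChoices-≤ j X no𝓠 ⟩
    suc j * (bad X * M)         ≡⟨ *-assoc (suc j) (bad X) M ⟨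
    suc j * bad X * M           ∎)
    where
    open ≤-Reasoning
    M = iteratedChoose s j (∣ X ∣ ∸ s)
    M>0 : 0 < M
    M>0 = 0<iteratedChoose s j (suc*≤⇒*≤∸ j s js≤∣X∣)

-- 1-focal families from disjoint good sets

length-filter-tabulate-all : ∀ {P : Pred A p} (P? : Decidable P) {m} (f : Fin m → A) →
  (∀ i → P (f i)) → m ≤ length (filter P? (tabulate f))
length-filter-tabulate-all P? f Pf =
  ≤-reflexive (trans (sym (length-tabulate f)) (cong length (sym (filter-all P? (tabulate⁺ Pf)))))

length-filter-tabulate-allBut : ∀ {P : Pred A p} (P? : Decidable P) {m} (f : Fin (suc m) → A) i₀ →
  (∀ i → i ≢ i₀ → P (f i)) → m ≤ length (filter P? (tabulate f))
length-filter-tabulate-allBut P? f zero Pf =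
  ≤-trans (length-filter-tabulate-all P? (f ∘ suc) (λ i → Pf (suc i) λ ()))
          (length-filter-∷ (f zero) (tabulate (f ∘ suc)))
  where
  length-filter-∷ : ∀ x xs → length (filter P? xs) ≤ length (filter P? (x ∷ xs))
  length-filter-∷ x xs with P? x
  ... | yes _ = n≤1+n _
  ... | no _  = ≤-refl
length-filter-tabulate-allBut P? {suc m} f (suc i₀) Pf
  rewrite filter-accept P? {xs = tabulate (f ∘ suc)} (Pf zero λ ()) =
  s≤s (length-filter-tabulate-allBut P? (f ∘ suc) i₀ λ i i≢i₀ → Pf (suc i) (i≢i₀ ∘ Fin.suc-injective))

module _ (F : List (Subset n)) where

  CoveredByOther : Subset n → Subset n → Set
  CoveredByOther A T = Any (λ B → B ≢ A × T ⊆ B) F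

  coveredByOther? : ∀ A T → Dec (CoveredByOther A T)
  coveredByOther? A T = any? (λ B → ¬? (≡-dec Bool._≟_ B A) ×-dec T ⊆? B) F

  coveringFamily⇒oneFocal : ∀ {k m A} → All (λ B → ∣ B ∣ ≡ k) F → A ∈ₗ F →
    DisjointFamily (CoveredByOther A ∘ (A ─_)) (suc m) A → ContainsOneFocal (suc (suc m)) F
  coveringFamily⇒oneFocal {k} {m} {A} sizes A∈F 𝓠 = xs , zero , xs∈F , xs-injective , focal
    where
    open DisjointFamily 𝓠
    cover : Fin (suc m) → Subset n
    cover i = proj₁ (find (good i))
    cover∈F : ∀ i → cover i ∈ₗ F
    cover∈F i = proj₁ (proj₂ (find (good i)))
    cover≢A : ∀ i → cover i ≢ A
    cover≢A i = proj₁ (proj₂ (proj₂ (find (good i))))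
    ∈cover : ∀ i {x} → x ∈ A → x ∉ member i → x ∈ cover i
    ∈cover i x∈A x∉Qi = proj₂ (proj₂ (proj₂ (find (good i)))) (x∈p∧x∉q⇒x∈p─q x∈A x∉Qi)

    xs : Fin (suc (suc m)) → Subset n
    xs zero    = A
    xs (suc i) = cover i
    xs∈F : ∀ i → xs i ∈ₗ F
    xs∈F zero    = A∈F
    xs∈F (suc i) = cover∈F i

    -- cover i ⊇ A ─ member i and cover i′ ⊇ A ─ member i′, where member i and member i′ are disjoint.
    A⊆cover : ∀ {i i′} → i ≢ i′ → cover i ≡ cover i′ → A ⊆ cover i
    A⊆cover {i} {i′} i≢i′ eq {x} x∈A with x ∈? member i
    ... | no x∉Qi  = ∈cover i x∈A x∉Qi
    ... | yes x∈Qi = subst (x ∈_) (sym eq) (∈cover i′ x∈A (disjoint i≢i′ x∈Qi))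
    cover-injective : ∀ {i i′} → cover i ≡ cover i′ → i ≡ i′
    cover-injective {i} {i′} eq with i Fin.≟ i′
    ... | yes i≡i′ = i≡i′
    ... | no i≢i′  = contradiction (⊆∧∣∣≡⇒≡ (A⊆cover i≢i′ eq) sameSize) (cover≢A i ∘ sym)
      where
      sameSize : ∣ A ∣ ≡ ∣ cover i ∣
      sameSize = trans (All.lookup sizes A∈F) (sym (All.lookup sizes (cover∈F i)))
    xs-injective : Injective _≡_ _≡_ xs
    xs-injective {zero}  {zero}  _ = refl
    xs-injective {zero}  {suc j} e = contradiction (sym e) (cover≢A j)
    xs-injective {suc i} {zero}  e = contradiction e (cover≢A i)
    xs-injective {suc i} {suc j} e = cong suc (cover-injective e)

    focal : ∀ x → lookup A x ≡ true → m ≤ othersWithOne xs zero x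
    focal x x∈A with missesAllButOne 𝓠 x
    ... | i₀ , x∉Qi = length-filter-tabulate-allBut
      (λ j → ¬? (j Fin.≟ zero) ×-dec lookup (xs j) x Bool.≟ true) Fin.suc i₀ λ i i≢i₀ →
      (λ ()) , []=⇒lookup (∈cover i (lookup⇒[]= x A x∈A) (x∉Qi i i≢i₀))

-- Private subsets

module _ (F : List (Subset n)) (k t : ℕ) where

  coveredComplement? : ∀ A → Decidable (CoveredByOther F A ∘ (A ─_))
  coveredComplement? A Q = coveredByOther? F A (A ─ Q)

  uncoveredChoices : Subset n → ℕ
  uncoveredChoices A = DisjointChoices.bad (k ∸ t) (coveredComplement? A) A

  Private : Subset n → Subset n → Set
  Private A T = T ⊆ A × ¬ CoveredByOther F A T

  private? : ∀ A T → Dec (Private A T)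
  private? A T = T ⊆? A ×-dec ¬? (coveredByOther? F A T)

  uncoveredChoices≡∑private : ∀ {A} → ∣ A ∣ ≡ k → t ≤ k →
    uncoveredChoices A ≡ ∑[ T ∈ allSubsets n ] 𝟙 (∣ T ∣ ≟ t) * 𝟙 (private? A T)
  uncoveredChoices≡∑private {A} ∣A∣≡k t≤k = begin
    ∑[ Q ∈ allSubsets n ] 𝟙 (badChoice? Q)
      ≡⟨ ∑-cong (allSubsets n) (λ Q →
           trans (𝟙-⇔ (complementSize Q) (badChoice? Q) (Q ⊆? A ×-dec uncoveredOfSize? (A ─ Q)))
                 (𝟙-× (Q ⊆? A) (uncoveredOfSize? (A ─ Q)))) ⟩
    ∑[ Q ∈ allSubsets n ] 𝟙 (Q ⊆? A) * 𝟙 (uncoveredOfSize? (A ─ Q))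
      ≡⟨ ∑-─ n A (𝟙 ∘ uncoveredOfSize?) ⟩
    ∑[ T ∈ allSubsets n ] 𝟙 (T ⊆? A) * 𝟙 (uncoveredOfSize? T)
      ≡⟨ ∑-cong (allSubsets n) reorder ⟩
    ∑[ T ∈ allSubsets n ] 𝟙 (∣ T ∣ ≟ t) * 𝟙 (private? A T) ∎
    where
    open ≡-Reasoning
    badChoice? : ∀ Q → Dec (Q ⊆[ k ∸ t ] A × ¬ CoveredByOther F A (A ─ Q))
    badChoice? = DisjointChoices.badIn? (k ∸ t) (coveredComplement? A) A
    uncoveredOfSize? : ∀ T → Dec (∣ T ∣ ≡ t × ¬ CoveredByOther F A T)
    uncoveredOfSize? T = ∣ T ∣ ≟ t ×-dec ¬? (coveredByOther? F A T)
    complementSize : ∀ Q → (Q ⊆[ k ∸ t ] A × ¬ CoveredByOther F A (A ─ Q))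
                           ⇔ (Q ⊆ A × ∣ A ─ Q ∣ ≡ t × ¬ CoveredByOther F A (A ─ Q))
    complementSize Q = mk⇔
      (λ ((∣Q∣ , Q⊆A) , ¬C) → Q⊆A , Equivalence.to (∣∣≡∸⇔∣─∣≡ Q⊆A ∣A∣≡k t≤k) ∣Q∣ , ¬C)
      (λ (Q⊆A , ∣A─Q∣ , ¬C) → (Equivalence.from (∣∣≡∸⇔∣─∣≡ Q⊆A ∣A∣≡k t≤k) ∣A─Q∣ , Q⊆A) , ¬C)
    reorder : ∀ T → 𝟙 (T ⊆? A) * 𝟙 (uncoveredOfSize? T) ≡ 𝟙 (∣ T ∣ ≟ t) * 𝟙 (private? A T)
    reorder T = begin
      𝟙 (T ⊆? A) * 𝟙 (∣ T ∣ ≟ t ×-dec ¬? (coveredByOther? F A T))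
        ≡⟨ cong (𝟙 (T ⊆? A) *_) (𝟙-× (∣ T ∣ ≟ t) (¬? (coveredByOther? F A T))) ⟩
      𝟙 (T ⊆? A) * (𝟙 (∣ T ∣ ≟ t) * 𝟙 (¬? (coveredByOther? F A T)))
        ≡⟨ x∙yz≈y∙xz (𝟙 (T ⊆? A)) (𝟙 (∣ T ∣ ≟ t)) _ ⟩
      𝟙 (∣ T ∣ ≟ t) * (𝟙 (T ⊆? A) * 𝟙 (¬? (coveredByOther? F A T)))
        ≡⟨ cong (𝟙 (∣ T ∣ ≟ t) *_) (𝟙-× (T ⊆? A) (¬? (coveredByOther? F A T))) ⟨
      𝟙 (∣ T ∣ ≟ t) * 𝟙 (private? A T) ∎

  private-unique : ∀ {T A A′} → A′ ∈ₗ F → Private A T → Private A′ T → A ≡ A′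
  private-unique {A = A} {A′} A′∈F (_ , ¬covered) (T⊆A′ , _) with ≡-dec Bool._≟_ A′ A
  ... | yes A′≡A = sym A′≡A
  ... | no A′≢A  = contradiction (lose A′∈F (A′≢A , λ {_} → T⊆A′)) ¬covered

  ∑-uncoveredChoices≤ : t ≤ k → Unique F → All (λ A → ∣ A ∣ ≡ k) F → ∑ F uncoveredChoices ≤ n C t
  ∑-uncoveredChoices≤ t≤k unique sizes = begin
    ∑ F uncoveredChoices
      ≤⟨ ∑-mono-∈ F (λ A∈F → ≤-reflexive (uncoveredChoices≡∑private (All.lookup sizes A∈F) t≤k)) ⟩
    ∑[ A ∈ F ] ∑[ T ∈ allSubsets n ] 𝟙 (∣ T ∣ ≟ t) * 𝟙 (private? A T)
      ≡⟨ ∑-comm F (allSubsets n) _ ⟩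
    ∑[ T ∈ allSubsets n ] ∑[ A ∈ F ] 𝟙 (∣ T ∣ ≟ t) * 𝟙 (private? A T)
      ≡⟨ ∑-cong (allSubsets n) (λ T → *-distribˡ-∑ F (𝟙 (∣ T ∣ ≟ t)) (λ A → 𝟙 (private? A T))) ⟩
    ∑[ T ∈ allSubsets n ] 𝟙 (∣ T ∣ ≟ t) * (∑[ A ∈ F ] 𝟙 (private? A T))
      ≤⟨ ∑-mono (allSubsets n) (λ T → *-monoʳ-≤ (𝟙 (∣ T ∣ ≟ t))
           (∑-𝟙≤1 (λ A → private? A T) unique λ _ A′∈F → private-unique A′∈F)) ⟩
    ∑[ T ∈ allSubsets n ] 𝟙 (∣ T ∣ ≟ t) * 1
      ≡⟨ ∑-cong (allSubsets n) (λ T → trans (*-identityʳ _)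
           (𝟙-⇔ (mk⇔ (λ ∣T∣≡t → ∣T∣≡t , λ {_} → ⊆⊤) proj₁) (∣ T ∣ ≟ t) (T ⊆[ t ]? ⊤))) ⟩
    ∑[ T ∈ allSubsets n ] 𝟙 (T ⊆[ t ]? ⊤)
      ≡⟨ ∑-⊆[] n t ⊤ ⟩
    ∣ ⊤ {n} ∣ C t
      ≡⟨ cong (_C t) (∣⊤∣≡n n) ⟩
    n C t ∎
    where open ≤-Reasoning

-- Ceiling arithmetic

⌈/⌉≤ : ∀ a b c → a ≤ c * suc b → ⌈ a / suc b ⌉ ≤ c
⌈/⌉≤ a b c a≤c*[1+b] = s≤s⁻¹ (m<n*o⇒m/o<n (begin-strict
  a + b             ≤⟨ +-monoˡ-≤ b a≤c*[1+b] ⟩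
  c * suc b + b     <⟨ +-monoʳ-< (c * suc b) (n<1+n b) ⟩
  c * suc b + suc b ≡⟨ +-comm (c * suc b) (suc b) ⟩
  suc c * suc b     ∎))
  where open ≤-Reasoning

≤⌈/⌉* : ∀ a b → a ≤ ⌈ a / suc b ⌉ * suc b
≤⌈/⌉* a b = +-cancelʳ-≤ b a (q * suc b) (begin
  a + b                       ≡⟨ m≡m%n+[m/n]*n (a + b) (suc b) ⟩
  (a + b) % suc b + q * suc b ≤⟨ +-monoˡ-≤ (q * suc b) (s≤s⁻¹ (m%n<n (a + b) (suc b))) ⟩
  b + q * suc b               ≡⟨ +-comm b (q * suc b) ⟩
  q * suc b + b               ∎)
  where
  open ≤-Reasoning
  q = ⌈ a / suc b ⌉

⌈*/suc⌉≤ : ∀ b k → ⌈ b * k / suc b ⌉ ≤ k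
⌈*/suc⌉≤ b k = ⌈/⌉≤ (b * k) b k (≤-trans (*-monoˡ-≤ k (n≤1+n b)) (≤-reflexive (*-comm (suc b) k)))

suc*[∸⌈*/suc⌉]≤ : ∀ b k → suc b * (k ∸ ⌈ b * k / suc b ⌉) ≤ k
suc*[∸⌈*/suc⌉]≤ b k = begin
  suc b * (k ∸ t)       ≡⟨ *-distribˡ-∸ (suc b) k t ⟩
  suc b * k ∸ suc b * t ≤⟨ ∸-monoʳ-≤ (suc b * k) b*k≤[1+b]*t ⟩
  k + b * k ∸ b * k     ≡⟨ m+n∸n≡m k (b * k) ⟩
  k                     ∎
  where
  open ≤-Reasoning
  t = ⌈ b * k / suc b ⌉
  b*k≤[1+b]*t : b * k ≤ suc b * t
  b*k≤[1+b]*t = ≤-trans (≤⌈/⌉* (b * k) b) (≤-reflexive (*-comm t (suc b)))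

theorem4 : (r n k : ℕ) → 3 ≤ r → k ≤ n →
    (F : List (Subset n)) → IsKFamily k F → ¬ ContainsOneFocal r F →
    length F * (k C ⌈ (r ∸ 2) * k / (r ∸ 1) ⌉) ≤ (r ∸ 1) * (n C ⌈ (r ∸ 2) * k / (r ∸ 1) ⌉)
theorem4 1 _ _ (s≤s ()) _ _ _ _
theorem4 2 _ _ (s≤s (s≤s ())) _ _ _ _
theorem4 (suc (suc (suc b))) n k _ _ F (unique , sizes) noFocal = begin
  length F * (k C t)                      ≡⟨ cong (length F *_) (nCk≡nC[n∸k] t≤k) ⟩
  length F * (k C s)                      ≡⟨ ∑-const F (k C s) ⟨
  ∑[ _ ∈ F ] (k C s)                      ≤⟨ ∑-mono-∈ F C≤m*uncoveredChoices ⟩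
  ∑[ A ∈ F ] m * uncoveredChoices F k t A ≡⟨ *-distribˡ-∑ F m (uncoveredChoices F k t) ⟩
  m * ∑ F (uncoveredChoices F k t)        ≤⟨ *-monoʳ-≤ m (∑-uncoveredChoices≤ F k t t≤k unique sizes) ⟩
  m * (n C t)                             ∎
  where
  open ≤-Reasoning
  m = suc (suc b)
  t = ⌈ suc b * k / m ⌉
  s = k ∸ t
  t≤k : t ≤ k
  t≤k = ⌈*/suc⌉≤ (suc b) k
  C≤m*uncoveredChoices : ∀ {A} → A ∈ₗ F → k C s ≤ m * uncoveredChoices F k t A
  C≤m*uncoveredChoices {A} A∈F = subst (λ x → x C s ≤ m * uncoveredChoices F k t A) ∣A∣≡k
    (DisjointChoices.C≤*bad s (coveredComplement? F k t A) (suc b) A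
      (subst (m * s ≤_) (sym ∣A∣≡k) (suc*[∸⌈*/suc⌉]≤ (suc b) k))
      (noFocal ∘ coveringFamily⇒oneFocal F sizes A∈F))
    where
    ∣A∣≡k : ∣ A ∣ ≡ k
    ∣A∣≡k = All.lookup sizes A∈F
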